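{- Let $\mathbf G$ be a definite canonical system, and let $\mathcal{S}\cup\{s\}$ be a set of definite sequents. If there exists a proof $P$ of $s$ from $\mathcal S$ in $\mathbf G$, then there exists a proof $P'$ of $s$ from $\mathcal S$ in $\mathbf G$ in which every sequent is definite and every cut formula of $P'$ is also a cut formula in $P$.
   Context: $\mathcal{L}$ is a propositional language with atoms $p_1,p_2,\ldots$ and set of formulas $\mathcal{F}$. A sequent is $\Gamma\Rightarrow E$ with $\Gamma$ a finite set of formulas and $E$ a set of formulas with at most one element; it is definite if $E\neq\emptyset$. A clause is a sequent of atoms. An $\mathcal{L}$-substitution is a map $\sigma:\mathcal{F}\to\mathcal{F}$ commuting with all connectives, extended pointwise to sets. A canonical right-introduction rule for an $n$-ary connective $\diamond$ is $\{\Pi_i\Rightarrow E_i\}_{1\le i\le m}/\ \Rightarrow\diamond(p_1,\dots,p_n)$ with $m\ge0$ and $\Pi_i\cup E_i\subseteq\{p_1,\dots,p_n\}$; an application infers $\Gamma\Rightarrow\sigma(\diamond(p_1,\dots,p_n))$ from $\Gamma,\sigma(\Pi_i)\Rightarrow\sigma(E_i)$ ($1\le i\le m$), for any finite $\Gamma$ and substitution $\sigma$. A canonical left-introduction rule is $\langle\{\Pi_i\Rightarrow E_i\}_{1\le i\le m},\{\Sigma_j\Rightarrow\}_{1\le j\le k}\rangle/\ \diamond(p_1,\dots,p_n)\Rightarrow$ with all atoms among $p_1,\dots,p_n$ (hard premises $\Pi_i\Rightarrow E_i$, soft premises $\Sigma_j\Rightarrow$); an application infers $\Gamma,\sigma(\diamond(p_1,\dots,p_n))\Rightarrow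 E$ from $\Gamma,\sigma(\Pi_i)\Rightarrow\sigma(E_i)$ and $\Gamma,\sigma(\Sigma_j)\Rightarrow E$, for any sequent $\Gamma\Rightarrow E$ and substitution $\sigma$. A canonical system has axioms $\varphi\Rightarrow\varphi$, weakening (from $\Gamma\Rightarrow E$ infer $\Gamma,\Delta\Rightarrow E$; from $\Gamma\Rightarrow$ infer $\Gamma\Rightarrow\psi$), cut (from $\Gamma\Rightarrow\varphi$ and $\Delta,\varphi\Rightarrow E$ infer $\Gamma,\Delta\Rightarrow E$; $\varphi$ is the cut formula), and a set of canonical right- and left-introduction rules. It is definite iff all premises of its right-introduction rules and all hard premises of its left-introduction rules are definite clauses. A proof of $s$ from $\mathcal S$ is a derivation of $s$ in $\mathbf G$ using the sequents of $\mathcal S$ as extra axioms. -}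

module Defs where

open import Data.Nat using (ℕ)
open import Data.Fin using (Fin)
open import Data.Vec using (Vec)
import Data.Vec as Vec
open import Data.List using (List; []; _∷_; _++_; length)
import Data.List as List
open import Data.Maybe using (Maybe; just; nothing; Is-just)
import Data.Maybe as Maybe
open import Data.List.Membership.Propositional using (_∈_)
open import Data.List.Relation.Unary.All using (All)
open import Data.Product using (Σ; _×_; ∃)
open import Data.Sum using (_⊎_)
open import Data.Empty using (⊥)
open import Data.Unit using (⊤)
open import Relation.Binary.PropositionalEquality using (_≡_)

record Signature : Set₁ where
  field
    Con : Set
    ar  : Con → ℕ

open Signature public

data Form (L : Signature) : Set where
  atom : ℕ → Form L
  app  : (c : Con L) → Vec (Form L) (ar L c) → Form L

-- A sequent Γ ⇒ E.  Γ is a finite set, represented by a list taken up to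
-- set-equality (see the `perm` rule below); E is a set with at most one
-- element, represented by Maybe.
record Seq (L : Signature) : Set where
  constructor _⇒_
  field
    ante : List (Form L)
    succ : Maybe (Form L)

open Seq public

Definite : ∀ {L} → Seq L → Set
Definite s = Is-just (succ s)

_≈ₛ_ : ∀ {L} → List (Form L) → List (Form L) → Set
Γ ≈ₛ Δ = ∀ φ → (φ ∈ Γ → φ ∈ Δ) × (φ ∈ Δ → φ ∈ Γ)

-- Clauses over the atoms p_1..p_n of a rule for an n-ary connective
-- (atom p_i is represented by i : Fin n).
record Clause (n : ℕ) : Set where
  constructor _⇒ᶜ_
  field
    cl-ante : List (Fin n)
    cl-succ : Maybe (Fin n)

open Clause public

DefiniteClause : ∀ {n} → Clause n → Set
DefiniteClause c = Is-just (cl-succ c)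

-- Canonical right-introduction rule  {Π_i ⇒ E_i}_i / ⇒ ⋄(p_1,...,p_n)
record RightRule (n : ℕ) : Set where
  field
    rprems : List (Clause n)

open RightRule public

-- Canonical left-introduction rule  <{Π_i ⇒ E_i}_i , {Σ_j ⇒}_j> / ⋄(p_1,...,p_n) ⇒
record LeftRule (n : ℕ) : Set where
  field
    hard : List (Clause n)
    soft : List (List (Fin n))

open LeftRule public

-- A canonical system: a set of canonical right and left rules for each connective
-- (axioms, weakening and cut are built into the derivation type below).
record System (L : Signature) : Set₁ where
  field
    RR : (c : Con L) → RightRule (ar L c) → Set
    LR : (c : Con L) → LeftRule (ar L c) → Set

open System public

DefiniteSystem : ∀ {L} → System L → Set
DefiniteSystem {L} G =
  (∀ c r → RR G c r → All DefiniteClause (rprems r)) ×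
  (∀ c r → LR G c r → All DefiniteClause (hard r))

-- Application of a substitution σ to atoms of a rule for ⋄ of arity n:
-- σ is determined (on p_1..p_n) by the vector args = (σ p_1, ..., σ p_n),
-- and σ(⋄(p_1,...,p_n)) = ⋄(args).
instCtx : ∀ {L n} → Vec (Form L) n → List (Fin n) → List (Form L)
instCtx args Π = List.map (Vec.lookup args) Π

instSucc : ∀ {L n} → Vec (Form L) n → Maybe (Fin n) → Maybe (Form L)
instSucc args E = Maybe.map (Vec.lookup args) E

data Der {L : Signature} (G : System L) (S : Seq L → Set) : Seq L → Set where
  ax    : (φ : Form L) → Der G S ((φ ∷ []) ⇒ just φ)
  hyp   : ∀ {s} → S s → Der G S s
  perm  : ∀ {Γ Γ' E} → Γ ≈ₛ Γ' → Der G S (Γ ⇒ E) → Der G S (Γ' ⇒ E)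
  wkL   : ∀ {Γ E} (Δ : List (Form L)) → Der G S (Γ ⇒ E) → Der G S ((Γ ++ Δ) ⇒ E)
  wkR   : ∀ {Γ} (ψ : Form L) → Der G S (Γ ⇒ nothing) → Der G S (Γ ⇒ just ψ)
  cut   : ∀ {Γ Δ E} (φ : Form L) → Der G S (Γ ⇒ just φ) → Der G S ((φ ∷ Δ) ⇒ E) →
          Der G S ((Γ ++ Δ) ⇒ E)
  right : ∀ {c r} → RR G c r → (Γ : List (Form L)) (args : Vec (Form L) (ar L c)) →
          ((i : Fin (length (rprems r))) →
             Der G S ((Γ ++ instCtx args (cl-ante (List.lookup (rprems r) i)))
                        ⇒ instSucc args (cl-succ (List.lookup (rprems r) i)))) →
          Der G S (Γ ⇒ just (app c args))
  left  : ∀ {c r} → LR G c r → (Γ : List (Form L)) (E : Maybe (Form L))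
          (args : Vec (Form L) (ar L c)) →
          ((i : Fin (length (hard r))) →
             Der G S ((Γ ++ instCtx args (cl-ante (List.lookup (hard r) i)))
                        ⇒ instSucc args (cl-succ (List.lookup (hard r) i)))) →
          ((j : Fin (length (soft r))) →
             Der G S ((Γ ++ instCtx args (List.lookup (soft r) j)) ⇒ E)) →
          Der G S ((app c args ∷ Γ) ⇒ E)

AllDefinite : ∀ {L} {G : System L} {S : Seq L → Set} {s} → Der G S s → Set
AllDefinite {s = s} (ax φ) = Definite s
AllDefinite {s = s} (hyp x) = Definite s
AllDefinite {s = s} (perm x d) = Definite s × AllDefinite d
AllDefinite {s = s} (wkL Δ d) = Definite s × AllDefinite d
AllDefinite {s = s} (wkR ψ d) = Definite s × AllDefinite d
AllDefinite {s = s} (cut φ d e) = Definite s × AllDefinite d × AllDefinite e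
AllDefinite {s = s} (right x Γ args ds) = Definite s × (∀ i → AllDefinite (ds i))
AllDefinite {s = s} (left x Γ E args ds es) =
  Definite s × (∀ i → AllDefinite (ds i)) × (∀ j → AllDefinite (es j))

CutFormulaOf : ∀ {L} {G : System L} {S : Seq L → Set} {s} → Form L → Der G S s → Set
CutFormulaOf φ (ax ψ) = ⊥
CutFormulaOf φ (hyp x) = ⊥
CutFormulaOf φ (perm x d) = CutFormulaOf φ d
CutFormulaOf φ (wkL Δ d) = CutFormulaOf φ d
CutFormulaOf φ (wkR ψ d) = CutFormulaOf φ d
CutFormulaOf φ (cut ψ d e) = φ ≡ ψ ⊎ CutFormulaOf φ d ⊎ CutFormulaOf φ e
CutFormulaOf φ (right x Γ args ds) = Σ _ λ i → CutFormulaOf φ (ds i)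
CutFormulaOf φ (left x Γ E args ds es) =
  (Σ _ λ i → CutFormulaOf φ (ds i)) ⊎ (Σ _ λ j → CutFormulaOf φ (es j))

module Submission where

open import Defs
open import Data.Product using (Σ; _×_; _,_; proj₁; proj₂)
open import Data.Fin using (Fin)
open import Data.List using (List; length; lookup)
open import Data.List.Membership.Propositional.Properties using (∈-lookup)
open import Data.List.Relation.Unary.All using (All)
import Data.List.Relation.Unary.All as All
open import Data.Maybe using (Maybe; just; nothing; Is-just)
import Data.Maybe as Maybe
import Data.Maybe.Relation.Unary.Any as Any
open import Data.Sum using (inj₁; inj₂)
open import Data.Unit using (tt)
open import Data.Vec using (Vec)
import Data.Vec as Vec
open import Function using (_∘_)

-- A derivation of Γ ⇒ E is rebuilt, by recursion on its structure, as a
-- derivation of Γ ⇒ F for any definite F refining E.  Right weakening is the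
-- only rule that empties a succedent; it is dropped and its premise Γ ⇒ is
-- rebuilt with the target of the conclusion instead.  Every other rule is kept,
-- with the same cut formulas: a left rule's soft premises share the
-- conclusion's succedent, and all other premises are definite because G is.
-- An empty succedent never reaches a leaf, as axioms and the sequents of S are
-- definite.

data _⊑_ {A : Set} : Maybe A → Maybe A → Set where
  just⊑just    : ∀ {a} → just a ⊑ just a
  nothing⊑just : ∀ {a} → nothing ⊑ just a

⊑⇒Is-just : ∀ {A : Set} {E F : Maybe A} → E ⊑ F → Is-just F
⊑⇒Is-just just⊑just    = Any.just tt
⊑⇒Is-just nothing⊑just = Any.just tt

Is-just⇒⊑-refl : ∀ {A : Set} {E : Maybe A} → Is-just E → E ⊑ E
Is-just⇒⊑-refl (Any.just _) = just⊑just

Is-just-map : ∀ {A B : Set} (f : A → B) {m : Maybe A} → Is-just m → Is-just (Maybe.map f m)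
Is-just-map f (Any.just _) = Any.just tt

instSucc-definite : ∀ {L n} (args : Vec (Form L) n) {cs : List (Clause n)} →
                    All DefiniteClause cs → (i : Fin (length cs)) →
                    Is-just (instSucc args (cl-succ (lookup cs i)))
instSucc-definite args definite-cs i =
  Is-just-map (Vec.lookup args) (All.lookup definite-cs (∈-lookup i))

module _ {L : Signature} {G : System L} (definite-G : DefiniteSystem G)
         {S : Seq L → Set} (definite-S : ∀ t → S t → Definite t) where

  record Definitization {Γ E} (d : Der G S (Γ ⇒ E)) (F : Maybe (Form L)) : Set where
    constructor definitized
    field
      derivation     : Der G S (Γ ⇒ F)
      all-definite   : AllDefinite derivation
      cuts-preserved : ∀ φ → CutFormulaOf φ derivation → CutFormulaOf φ d

  open Definitization

  definitize : ∀ {Γ E F} (d : Der G S (Γ ⇒ E)) → E ⊑ F → Definitization d F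
  definitize (ax φ) just⊑just = definitized (ax φ) (Any.just tt) λ _ ()
  definitize (hyp {_ ⇒ just _} s∈S) just⊑just = definitized (hyp s∈S) (Any.just tt) λ _ ()
  definitize (hyp {_ ⇒ nothing} s∈S) nothing⊑just with () ← definite-S _ s∈S
  definitize (perm Γ≈Γ' d) E⊑F =
    let definitized d' d'-def d'-cuts = definitize d E⊑F
    in definitized (perm Γ≈Γ' d') (⊑⇒Is-just E⊑F , d'-def) d'-cuts
  definitize (wkL Δ d) E⊑F =
    let definitized d' d'-def d'-cuts = definitize d E⊑F
    in definitized (wkL Δ d') (⊑⇒Is-just E⊑F , d'-def) d'-cuts
  definitize (wkR ψ d) just⊑just =
    let definitized d' d'-def d'-cuts = definitize d nothing⊑just
    in definitized d' d'-def d'-cuts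
  definitize (cut φ d e) E⊑F =
    let definitized d' d'-def d'-cuts = definitize d just⊑just
        definitized e' e'-def e'-cuts = definitize e E⊑F
    in definitized (cut φ d' e') (⊑⇒Is-just E⊑F , d'-def , e'-def) λ where
         ψ (inj₁ ψ≡φ)        → inj₁ ψ≡φ
         ψ (inj₂ (inj₁ ψ∈d)) → inj₂ (inj₁ (d'-cuts ψ ψ∈d))
         ψ (inj₂ (inj₂ ψ∈e)) → inj₂ (inj₂ (e'-cuts ψ ψ∈e))
  definitize (right {c} {r} rr Γ args ds) just⊑just =
    definitized (right rr Γ args (derivation ∘ ds')) (Any.just tt , all-definite ∘ ds')
      λ { ψ (i , ψ∈dᵢ) → i , cuts-preserved (ds' i) ψ ψ∈dᵢ }
    where
      ds' : ∀ i → Definitization (ds i) _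
      ds' i = definitize (ds i)
                (Is-just⇒⊑-refl (instSucc-definite args (proj₁ definite-G c r rr) i))
  definitize (left {c} {r} lr Γ E args ds es) E⊑F =
    definitized (left lr Γ _ args (derivation ∘ ds') (derivation ∘ es'))
      (⊑⇒Is-just E⊑F , all-definite ∘ ds' , all-definite ∘ es') λ where
        ψ (inj₁ (i , ψ∈dᵢ)) → inj₁ (i , cuts-preserved (ds' i) ψ ψ∈dᵢ)
        ψ (inj₂ (j , ψ∈eⱼ)) → inj₂ (j , cuts-preserved (es' j) ψ ψ∈eⱼ)
    where
      ds' : ∀ i → Definitization (ds i) _
      ds' i = definitize (ds i)
                (Is-just⇒⊑-refl (instSucc-definite args (proj₂ definite-G c r lr) i))
      es' : ∀ j → Definitization (es j) _
      es' j = definitize (es j) E⊑F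

lemma6p16 : (L : Signature) (G : System L) → DefiniteSystem G →
    (S : Seq L → Set) (s : Seq L) →
    (∀ t → S t → Definite t) → Definite s →
    (P : Der G S s) →
    Σ (Der G S s) λ P' →
    AllDefinite P' × (∀ φ → CutFormulaOf φ P' → CutFormulaOf φ P)
lemma6p16 L G definite-G S s definite-S definite-s P =
  let definitized P' P'-def P'-cuts = definitize definite-G definite-S P (Is-just⇒⊑-refl definite-s)
  in P' , P'-def , P'-cuts
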